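{- If $n\ge m\ge 3$, then $\widehat{\chi}_{\rho}(K_m, K_n) = mn - 2m + 2$, and if $m\ge n\ge 3$, then $\widehat{\chi}_{\rho}(K_m, K_n) = mn - m - n + 2$.
   Context: For graphs $G$ and $H$ and a function $f\colon V(G)\to V(H)$, the Sierpiński product $G\otimes_f H$ is the graph with vertex set $V(G)\times V(H)$ whose edges are: $(g,h)(g,h')$ for every $g\in V(G)$ and every edge $hh'\in E(H)$; and $(g,f(g'))(g',f(g))$ for every edge $gg'\in E(G)$. Let $H^G$ denote the set of all functions $V(G)\to V(H)$. For a graph $X$, a packing $k$-coloring is a map $c\colon V(X)\to\{1,\dots,k\}$ such that whenever $u\neq v$ and $c(u)=c(v)=\ell$, the shortest-path distance satisfies $d_X(u,v)>\ell$; the packing chromatic number $\chi_\rho(X)$ is the least $k$ for which a packing $k$-coloring exists. The upper Sierpiński packing chromatic number of the pair $(G,H)$ is $\widehat{\chi}_\rho(G,H)=\max_{f\in H^G}\chi_\rho(G\otimes_f H)$. $K_m$ denotes the complete graph on $m$ vertices. -}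

module Defs where

open import Data.Nat using (ℕ; zero; suc; _+_; _*_; _∸_; _≤_; _<_)
open import Data.Fin using (Fin)
open import Data.Product using (_×_; _,_; Σ; ∃)
open import Relation.Binary.PropositionalEquality using (_≡_; _≢_)
open import Relation.Nullary using (¬_)
open import Data.Sum using (_⊎_)

-- A graph: a vertex type with an (irreflexive, symmetric in our uses) edge relation.
record Graph : Set₁ where
  field
    V : Set
    E : V → V → Set
open Graph public

K : ℕ → Graph
K m = record { V = Fin m ; E = λ x y → x ≢ y }

data SEdge (G H : Graph) (f : V G → V H) : V G × V H → V G × V H → Set where
  inner : ∀ g {h h'} → E H h h' → SEdge G H f (g , h) (g , h')
  outer : ∀ {g g'} → E G g g' → SEdge G H f (g , f g') (g' , f g)

Sierpinski : (G H : Graph) → (V G → V H) → Graph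
Sierpinski G H f = record { V = V G × V H ; E = SEdge G H f }

-- Walks of a given length (edges traversed in either direction, i.e. the
-- underlying undirected graph).
data Walk (X : Graph) : V X → V X → ℕ → Set where
  nil  : ∀ u → Walk X u u zero
  step : ∀ {u v w n} → (E X u v ⊎ E X v u) → Walk X v w n → Walk X u w (suc n)

DistLe : (X : Graph) → V X → V X → ℕ → Set
DistLe X u v ℓ = Σ ℕ λ n → n ≤ ℓ × Walk X u v n

-- d_X(u,v) > ℓ  (also true when u, v lie in different components).
DistGt : (X : Graph) → V X → V X → ℕ → Set
DistGt X u v ℓ = ¬ DistLe X u v ℓ

IsPackingColoring : (X : Graph) → ℕ → (V X → ℕ) → Set
IsPackingColoring X k c =
  (∀ u → 1 ≤ c u × c u ≤ k) ×
  (∀ u v → u ≢ v → c u ≡ c v → DistGt X u v (c u))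

HasPackingColoring : Graph → ℕ → Set
HasPackingColoring X k = Σ (V X → ℕ) λ c → IsPackingColoring X k c

IsPackingChromaticNumber : Graph → ℕ → Set
IsPackingChromaticNumber X k =
  HasPackingColoring X k × (∀ j → j < k → ¬ HasPackingColoring X j)

IsUpperSierpinskiPCN : Graph → Graph → ℕ → Set
IsUpperSierpinskiPCN G H k =
  (∀ (f : V G → V H) → Σ ℕ λ j → IsPackingChromaticNumber (Sierpinski G H f) j × j ≤ k) ×
  (Σ (V G → V H) λ f → IsPackingChromaticNumber (Sierpinski G H f) k)

-- The Sierpiński product X = K_m ⊗_f K_n has diameter at most 3, so in a packing colouring
-- every colour ℓ ≥ 3 is used at most once: a packing k-colouring (k ≥ 2) exists exactly when
-- mn ≤ α + (k − 2), where α is the largest size of an independent set (colour 1) together with a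
-- disjoint 2-packing (colour 2).
--
-- Every f admits such a pair with m + min(m, n) vertices. If f is onto, take the vertices
-- (g, σ (f g)) for a map σ with neither fixed points nor 2-cycles, and one vertex
-- (g, f g) over each value of f. If f misses two values, take their two rows. If f misses
-- exactly one value h₀, take the row of h₀, one vertex (g, f g) over each value of f, and,
-- when f is not injective, one more vertex in a copy g that was not chosen.
--
-- Conversely, for every f a 1- or 2-packing meets each copy at most once, so α ≤ 2m; and if f is
-- the identity on the first n copies and constant on the others, all vertices with the same
-- label (the position, in copies over the constant value, and f g elsewhere) are at distance
-- at most 2, so 2-packings have at most n vertices and α ≤ m + n.
--
-- Constructively, the packing chromatic number is the least k admitting a packing k-colouring,
-- which is decidable by exhaustive search because X is finite.

module Submission where

open import Defs
open import Data.Nat using (ℕ; zero; suc; _+_; _*_; _⊓_; _∸_; _≤_; _<_; z≤n; s≤s; _≤?_; _<?_; _≟_)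
open import Data.Nat.Properties
open import Data.Nat.Induction using (<-rec)
open import Data.Fin as Fin using (Fin; toℕ; splitAt; join)
open import Data.Fin.Patterns using (0F; 1F; 2F)
import Data.Fin.Properties as Fin
open import Data.Vec.Functional using (head; tail) renaming (_∷_ to _∷ᵛ_)
open import Data.Product using (∃; _×_; _,_; proj₁; proj₂)
open import Data.Sum using (_⊎_; inj₁; inj₂; [_,_]′; swap)
open import Data.Empty using (⊥-elim)
open import Data.List using (List; []; _∷_; filter; length; tabulate; lookup)
open import Data.List.Properties using (length-tabulate)
open import Data.List.Membership.Propositional using (_∈_)
open import Data.List.Membership.Propositional.Properties using (∈-filter⁺; ∈-tabulate⁺)
open import Data.List.Relation.Unary.Any using (index)
open import Data.List.Relation.Unary.Any.Properties using (lookup-index)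
open import Function using (_∘_; id; _↔_; Inverse; Injection; Injective; Equivalence; _⇔_; mk⇔)
open import Function.Properties.Inverse using (↔-refl; ↔-sym; ↔-trans; ↔⇒↣)
open import Data.Sum.Function.Propositional using (_⊎-↔_)
import Data.Sum.Properties as Sum
open import Relation.Binary using (DecidableEquality)
open import Relation.Binary.PropositionalEquality
open import Relation.Nullary using (Dec; yes; no; ¬_; ¬?)
open import Relation.Nullary.Decidable as Dec using (_×-dec_; _⊎-dec_; _→-dec_; decidable-stable)
open import Relation.Unary using (Pred; Decidable; _∪_; _⊥_; ｛_｝)
open import Relation.Unary.Properties using (∁?; _∪?_)
open import Level using (0ℓ)

private variable
  A : Set
  a b k ℓ ℓ′ N : ℕ

-- Search and counting

Least : Pred ℕ 0ℓ → ℕ → Set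
Least P j = P j × (∀ i → i < j → ¬ P i)

least : ∀ {P : Pred ℕ 0ℓ} → Decidable P → P k → ∃ λ j → Least P j × j ≤ k
least {P = P} P? = <-rec (λ k → P k → ∃ λ j → Least P j × j ≤ k) search _
  where
  search : ∀ k → (∀ {i} → i < k → P i → ∃ λ j → Least P j × j ≤ i) → P k → ∃ λ j → Least P j × j ≤ k
  search k below pk with anyUpTo? P? k
  ... | yes (i , i<k , pi) = let j , least-j , j≤i = below i<k pi in j , least-j , ≤-trans j≤i (<⇒≤ i<k)
  ... | no none            = k , (pk , λ i i<k pi → none (i , i<k , pi)) , ≤-refl

∃-bounded? : ∀ N k {P : Pred (Fin N → ℕ) 0ℓ} → (∀ {c c′} → c ≗ c′ → P c → P c′) → Decidable P →
             (∀ {c} → P c → ∀ i → c i ≤ k) → Dec (∃ P)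
∃-bounded? zero    k resp P? bounded =
  Dec.map′ (λ p → empty , p) (λ (c , p) → resp {c′ = empty} (λ ()) p) (P? empty)
  where
  empty : Fin 0 → ℕ
  empty ()
∃-bounded? (suc N) k resp P? bounded =
  Dec.map′ (λ (v , _ , c , p) → v ∷ᵛ c , p)
           (λ (c , p) → head c , s≤s (bounded p Fin.zero) , tail c , resp head∷tail p)
           (anyUpTo? (λ v → ∃-bounded? N k (resp ∘ ∷-cong v) (P? ∘ (v ∷ᵛ_)) (λ p → bounded p ∘ Fin.suc))
                     (suc k))
  where
  ∷-cong : ∀ v {c c′ : Fin N → ℕ} → c ≗ c′ → (v ∷ᵛ c) ≗ (v ∷ᵛ c′)
  ∷-cong v c≗c′ Fin.zero    = refl
  ∷-cong v c≗c′ (Fin.suc i) = c≗c′ i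
  head∷tail : ∀ {c : Fin (suc N) → ℕ} → c ≗ (head c ∷ᵛ tail c)
  head∷tail Fin.zero    = refl
  head∷tail (Fin.suc i) = refl

record AtLeast {A : Set} (a : ℕ) (P : Pred A 0ℓ) : Set where
  constructor mkAtLeast
  field
    element           : Fin a → A
    element-injective : Injective _≡_ _≡_ element
    element-∈         : ∀ i → P (element i)

AtLeast-∪ : ∀ {P Q : Pred A 0ℓ} → P ⊥ Q → AtLeast a P → AtLeast b Q → AtLeast (a + b) (P ∪ Q)
AtLeast-∪ {A = A} {a = a} {b = b} {P = P} {Q = Q} P⊥Q
          (mkAtLeast e₁ e₁-inj e₁∈P) (mkAtLeast e₂ e₂-inj e₂∈Q) =
  mkAtLeast e e-injective (e∈P∪Q ∘ splitAt a)
  where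
  e : Fin (a + b) → A
  e = [ e₁ , e₂ ]′ ∘ splitAt a
  e∈P∪Q : ∀ s → (P ∪ Q) ([ e₁ , e₂ ]′ s)
  e∈P∪Q (inj₁ i) = inj₁ (e₁∈P i)
  e∈P∪Q (inj₂ j) = inj₂ (e₂∈Q j)
  [e₁,e₂]-injective : Injective _≡_ _≡_ [ e₁ , e₂ ]′
  [e₁,e₂]-injective {inj₁ i} {inj₁ j} eq = cong inj₁ (e₁-inj eq)
  [e₁,e₂]-injective {inj₁ i} {inj₂ j} eq = ⊥-elim (P⊥Q {e₁ i} (e₁∈P i , subst Q (sym eq) (e₂∈Q j)))
  [e₁,e₂]-injective {inj₂ i} {inj₁ j} eq = ⊥-elim (P⊥Q {e₁ j} (e₁∈P j , subst Q eq (e₂∈Q i)))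
  [e₁,e₂]-injective {inj₂ i} {inj₂ j} eq = cong inj₂ (e₂-inj eq)
  e-injective : Injective _≡_ _≡_ e
  e-injective {i} {j} eq = begin
    i                      ≡⟨ Fin.join-splitAt a b i ⟨
    join a b (splitAt a i) ≡⟨ cong (join a b) ([e₁,e₂]-injective {splitAt a i} {splitAt a j} eq) ⟩
    join a b (splitAt a j) ≡⟨ Fin.join-splitAt a b j ⟩
    j                      ∎
    where open ≡-Reasoning

AtLeast-｛｝ : ∀ {x : A} → AtLeast 1 ｛ x ｝
AtLeast-｛｝ {x = x} = mkAtLeast (λ _ → x) (λ { {Fin.zero} {Fin.zero} _ → refl }) (λ _ → refl)

length-filter-∁ : ∀ {P : Pred A 0ℓ} (P? : Decidable P) xs →
                  length (filter P? xs) + length (filter (∁? P?) xs) ≡ length xs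
length-filter-∁ P? []       = refl
length-filter-∁ P? (x ∷ xs) with P? x
... | yes _ = cong suc (length-filter-∁ P? xs)
... | no  _ = trans (+-suc _ _) (cong suc (length-filter-∁ P? xs))

AtLeast-⊆⇒≤ : ∀ {P : Pred A 0ℓ} {xs} → AtLeast a P → (∀ {x} → P x → x ∈ xs) → a ≤ length xs
AtLeast-⊆⇒≤ {xs = xs} (mkAtLeast e e-injective e∈P) P⊆xs =
  Fin.injective⇒≤ λ {i} {j} eq → e-injective (begin
    e i                              ≡⟨ lookup-index (P⊆xs (e∈P i)) ⟩
    lookup xs (index (P⊆xs (e∈P i))) ≡⟨ cong (lookup xs) eq ⟩
    lookup xs (index (P⊆xs (e∈P j))) ≡⟨ lookup-index (P⊆xs (e∈P j)) ⟨
    e j                              ∎)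
  where open ≡-Reasoning

≤-via-injection : ∀ {c} {f : Fin N → (Fin a ⊎ Fin b) ⊎ Fin c} → Injective _≡_ _≡_ f → N ≤ a + b + c
≤-via-injection {a = a} {b = b} {c = c} f-injective =
  Fin.injective⇒≤ (f-injective ∘ Injection.injective (↔⇒↣ (↔-sym sizes)))
  where
  sizes : Fin (a + b + c) ↔ ((Fin a ⊎ Fin b) ⊎ Fin c)
  sizes = ↔-trans Fin.+↔⊎ (Fin.+↔⊎ ⊎-↔ ↔-refl)

-- Distances and packings

IsPacking : (X : Graph) → ℕ → Pred (V X) 0ℓ → Set
IsPacking X ℓ P = ∀ {u v} → P u → P v → u ≢ v → DistGt X u v ℓ

record PackingPair (X : Graph) (a : ℕ) : Set₁ where
  field
    I₁ I₂      : Pred (V X) 0ℓ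
    I₁?        : Decidable I₁
    I₂?        : Decidable I₂
    I₁-packing : IsPacking X 1 I₁
    I₂-packing : IsPacking X 2 I₂
    size       : AtLeast a (I₁ ∪ I₂)

module _ {X : Graph} where
  private variable
    u v w : V X
    P Q : Pred (V X) 0ℓ

  _++ʷ_ : Walk X u v a → Walk X v w b → Walk X u w (a + b)
  nil _    ++ʷ q = q
  step e p ++ʷ q = step e (p ++ʷ q)

  DistLe-refl : DistLe X u u 0
  DistLe-refl {u = u} = 0 , z≤n , nil u

  DistLe-step : E X u v ⊎ E X v u → DistLe X u v 1
  DistLe-step e = 1 , ≤-refl , step e (nil _)

  DistLe-trans : DistLe X u v a → DistLe X v w b → DistLe X u w (a + b)
  DistLe-trans (i , i≤a , p) (j , j≤b , q) = i + j , +-mono-≤ i≤a j≤b , p ++ʷ q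

  DistLe-mono : a ≤ b → DistLe X u v a → DistLe X u v b
  DistLe-mono a≤b (i , i≤a , p) = i , ≤-trans i≤a a≤b , p

  DistLe-sym : DistLe X u v a → DistLe X v u a
  DistLe-sym (i , i≤a , p) = DistLe-mono i≤a (reverse p)
    where
    reverse : ∀ {u v j} → Walk X u v j → DistLe X v u j
    reverse (nil u)    = DistLe-refl
    reverse (step e p) =
      DistLe-mono (≤-reflexive (+-comm _ 1)) (DistLe-trans (reverse p) (DistLe-step (swap e)))

  DistLe-suc-⇔ : (u ≡ v ⊎ ∃ λ w → (E X u w ⊎ E X w u) × DistLe X w v ℓ) ⇔ DistLe X u v (suc ℓ)
  DistLe-suc-⇔ = mk⇔
    (λ { (inj₁ refl)                  → DistLe-mono z≤n DistLe-refl
       ; (inj₂ (_ , e , i , i≤ℓ , p)) → suc i , s≤s i≤ℓ , step e p })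
    (λ { (zero  , _       , nil _)    → inj₁ refl
       ; (suc i , s≤s i≤ℓ , step e p) → inj₂ (_ , e , i , i≤ℓ , p) })

  IsPackingColoring-resp : ∀ {c c′} → c ≗ c′ → IsPackingColoring X k c → IsPackingColoring X k c′
  IsPackingColoring-resp {k = k} c≗c′ (bounds , packing) =
    (λ u → subst (λ t → 1 ≤ t × t ≤ k) (c≗c′ u) (bounds u)) ,
    λ u v u≢v eq →
      subst (DistGt X u v) (c≗c′ u) (packing u v u≢v (trans (c≗c′ u) (trans eq (sym (c≗c′ v)))))

  IsPacking-mono : ℓ ≤ ℓ′ → IsPacking X ℓ′ P → IsPacking X ℓ P
  IsPacking-mono ℓ≤ℓ′ P-packing p q u≢v = P-packing p q u≢v ∘ DistLe-mono ℓ≤ℓ′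

  IsPacking-｛｝ : IsPacking X ℓ ｛ w ｝
  IsPacking-｛｝ refl refl u≢u = ⊥-elim (u≢u refl)

  IsPacking-∪ : IsPacking X ℓ P → IsPacking X ℓ Q →
                (∀ {u v} → P u → Q v → DistGt X u v ℓ) → IsPacking X ℓ (P ∪ Q)
  IsPacking-∪ P-packing Q-packing far (inj₁ p) (inj₁ p′) = P-packing p p′
  IsPacking-∪ P-packing Q-packing far (inj₁ p) (inj₂ q)  = λ _ → far p q
  IsPacking-∪ P-packing Q-packing far (inj₂ q) (inj₁ p)  = λ _ → far p q ∘ DistLe-sym
  IsPacking-∪ P-packing Q-packing far (inj₂ q) (inj₂ q′) = Q-packing q q′

-- Packing colourings of finite graphs

module FiniteGraph (X : Graph) {N : ℕ} (enumeration : V X ↔ Fin N) (E? : ∀ u v → Dec (E X u v)) where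
  open Inverse enumeration using (to; from; strictlyInverseˡ; strictlyInverseʳ)

  private variable
    P : Pred (V X) 0ℓ
    u v : V X

  _≟ᵥ_ : DecidableEquality (V X)
  _≟ᵥ_ = Dec.via-injection (↔⇒↣ enumeration) Fin._≟_

  ∃-vertex? : Decidable P → Dec (∃ P)
  ∃-vertex? {P} P? = Dec.map′ (λ (i , p) → from i , p)
                              (λ (u , p) → to u , subst P (sym (strictlyInverseʳ u)) p)
                              (Fin.any? (P? ∘ from))

  ∀-vertex? : Decidable P → Dec (∀ u → P u)
  ∀-vertex? {P} P? = Dec.map′ (λ all u → subst P (strictlyInverseʳ u) (all (to u)))
                              (λ all → all ∘ from)
                              (Fin.all? (P? ∘ from))

  DistLe? : ∀ ℓ u v → Dec (DistLe X u v ℓ)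
  DistLe? zero    u v = Dec.map′ (λ { refl → DistLe-refl })
                                 (λ { (zero , _ , nil _) → refl ; (suc _ , () , _) })
                                 (u ≟ᵥ v)
  DistLe? (suc ℓ) u v =
    Dec.map DistLe-suc-⇔ (u ≟ᵥ v ⊎-dec ∃-vertex? (λ w → (E? u w ⊎-dec E? w u) ×-dec DistLe? ℓ w v))

  IsPackingColoring? : ∀ k c → Dec (IsPackingColoring X k c)
  IsPackingColoring? k c =
    ∀-vertex? (λ u → 1 ≤? c u ×-dec c u ≤? k) ×-dec
    ∀-vertex? (λ u → ∀-vertex? λ v → ¬? (u ≟ᵥ v) →-dec (c u ≟ c v →-dec ¬? (DistLe? (c u) u v)))

  HasPackingColoring? : ∀ k → Dec (HasPackingColoring X k)
  HasPackingColoring? k =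
    Dec.map′ (λ (d , p) → d ∘ to , p)
             (λ (c , p) → c ∘ from , IsPackingColoring-resp (λ u → cong c (sym (strictlyInverseʳ u))) p)
             (∃-bounded? N k (λ d≗d′ → IsPackingColoring-resp (d≗d′ ∘ to))
                             (IsPackingColoring? k ∘ (_∘ to)) bounded)
    where
    bounded : ∀ {d} → IsPackingColoring X k (d ∘ to) → ∀ i → d i ≤ k
    bounded {d} (bounds , _) i = subst (_≤ k) (cong d (strictlyInverseˡ i)) (proj₂ (bounds (from i)))

  packingChromaticNumber-≤ : HasPackingColoring X k → ∃ λ j → IsPackingChromaticNumber X j × j ≤ k
  packingChromaticNumber-≤ = least HasPackingColoring?

  vertices : List (V X)
  vertices = tabulate from

  ∈-vertices : ∀ u → u ∈ vertices
  ∈-vertices u = subst (_∈ vertices) (strictlyInverseʳ u) (∈-tabulate⁺ (to u))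

  module _ (pair : PackingPair X a) where
    open PackingPair pair

    rest : List (V X)
    rest = filter (∁? (I₁? ∪? I₂?)) vertices

    length-rest : N ≤ a + k → length rest ≤ k
    length-rest {k} N≤a+k = +-cancelˡ-≤ a _ _ (begin
      a + length rest
        ≤⟨ +-monoˡ-≤ (length rest) (AtLeast-⊆⇒≤ size (∈-filter⁺ (I₁? ∪? I₂?) (∈-vertices _))) ⟩
      length (filter (I₁? ∪? I₂?) vertices) + length rest ≡⟨ length-filter-∁ (I₁? ∪? I₂?) vertices ⟩
      length vertices                                     ≡⟨ length-tabulate from ⟩
      N                                                   ≤⟨ N≤a+k ⟩
      a + k                                               ∎)
      where open ≤-Reasoning

    data Class (u : V X) : Set where
      first  : I₁ u → Class u
      second : I₂ u → Class u
      other  : u ∈ rest → Class u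

    class : ∀ u → Class u
    class u with I₁? u | I₂? u
    ... | yes i₁ | _      = first i₁
    ... | no ¬i₁ | yes i₂ = second i₂
    ... | no ¬i₁ | no ¬i₂ = other (∈-filter⁺ (∁? (I₁? ∪? I₂?)) (∈-vertices u) [ ¬i₁ , ¬i₂ ]′)

    colourOf : Class u → ℕ
    colourOf (first _)  = 1
    colourOf (second _) = 2
    colourOf (other p)  = 3 + toℕ (index p)

    colourOf-packing : (cu : Class u) (cv : Class v) → u ≢ v → colourOf cu ≡ colourOf cv →
                       DistGt X u v (colourOf cu)
    colourOf-packing (first i)  (first i′)  u≢v _  = I₁-packing i i′ u≢v
    colourOf-packing (second i) (second i′) u≢v _  = I₂-packing i i′ u≢v
    colourOf-packing (other p)  (other q)   u≢v eq = ⊥-elim (u≢v (begin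
      _                     ≡⟨ lookup-index p ⟩
      lookup rest (index p) ≡⟨ cong (lookup rest) (Fin.toℕ-injective (+-cancelˡ-≡ 3 _ _ eq)) ⟩
      lookup rest (index q) ≡⟨ lookup-index q ⟨
      _                     ∎))
      where open ≡-Reasoning
    colourOf-packing (first _)  (second _) _ ()
    colourOf-packing (first _)  (other _)  _ ()
    colourOf-packing (second _) (first _)  _ ()
    colourOf-packing (second _) (other _)  _ ()
    colourOf-packing (other _)  (first _)  _ ()
    colourOf-packing (other _)  (second _) _ ()

    colourOf-bounds : N ≤ a + k → (cu : Class u) → 1 ≤ colourOf cu × colourOf cu ≤ k + 2
    colourOf-bounds {k} _ (first _)  = s≤s z≤n , ≤-trans (s≤s z≤n) (m≤n+m 2 k)
    colourOf-bounds {k} _ (second _) = s≤s z≤n , m≤n+m 2 k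
    colourOf-bounds {k} N≤a+k (other p) = s≤s z≤n ,
      subst (_≤ k + 2) (+-comm (suc (toℕ (index p))) 2)
            (+-monoˡ-≤ 2 (≤-trans (Fin.toℕ<n (index p)) (length-rest N≤a+k)))

    PackingPair⇒HasPackingColoring : N ≤ a + k → HasPackingColoring X (k + 2)
    PackingPair⇒HasPackingColoring N≤a+k =
      colourOf ∘ class ,
      (λ u → colourOf-bounds N≤a+k (class u)) ,
      (λ u v u≢v → colourOf-packing (class u) (class v) u≢v)

  module _ (diameter≤3 : ∀ u v → DistLe X u v 3)
           (π : V X → Fin a) (π-DistLe : ∀ {u v} → π u ≡ π v → DistLe X u v 1)
           (ψ : V X → Fin b) (ψ-DistLe : ∀ {u v} → ψ u ≡ ψ v → DistLe X u v 2) where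

    slot : ∀ {j} ℓ → 1 ≤ ℓ → ℓ ≤ j → V X → (Fin a ⊎ Fin b) ⊎ Fin (j ∸ 2)
    slot 1                    _ _   u = inj₁ (inj₁ (π u))
    slot 2                    _ _   u = inj₁ (inj₂ (ψ u))
    slot (suc (suc (suc t)))  _ ℓ≤j _ = inj₂ (Fin.fromℕ< (∸-monoˡ-≤ 2 ℓ≤j))

    slot-≡⇒DistLe : ∀ {j} ℓ ℓ′ {1≤ℓ 1≤ℓ′} {ℓ≤j : ℓ ≤ j} {ℓ′≤j : ℓ′ ≤ j} →
                    slot ℓ 1≤ℓ ℓ≤j u ≡ slot ℓ′ 1≤ℓ′ ℓ′≤j v → ℓ ≡ ℓ′ × DistLe X u v ℓ
    slot-≡⇒DistLe 1 1 eq = refl , π-DistLe (Sum.inj₁-injective (Sum.inj₁-injective eq))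
    slot-≡⇒DistLe 2 2 eq = refl , ψ-DistLe (Sum.inj₂-injective (Sum.inj₁-injective eq))
    slot-≡⇒DistLe {u = u} {v} (suc (suc (suc t))) (suc (suc (suc t′))) eq =
      cong (3 +_) (trans (sym (Fin.toℕ-fromℕ< _))
                         (trans (cong toℕ (Sum.inj₂-injective eq)) (Fin.toℕ-fromℕ< _))) ,
      DistLe-mono (s≤s (s≤s (s≤s z≤n))) (diameter≤3 u v)
    slot-≡⇒DistLe 1                   2                   ()
    slot-≡⇒DistLe 1                   (suc (suc (suc _))) ()
    slot-≡⇒DistLe 2                   1                   ()
    slot-≡⇒DistLe 2                   (suc (suc (suc _))) ()
    slot-≡⇒DistLe (suc (suc (suc _))) 1                   ()
    slot-≡⇒DistLe (suc (suc (suc _))) 2                   ()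

    HasPackingColoring⇒≤ : ∀ {j} → HasPackingColoring X j → N ≤ a + b + (j ∸ 2)
    HasPackingColoring⇒≤ {j} (c , bounds , packing) =
      ≤-via-injection {f = slotOf ∘ from} slotOf∘from-injective
      where
      slotOf : V X → (Fin a ⊎ Fin b) ⊎ Fin (j ∸ 2)
      slotOf u = slot (c u) (proj₁ (bounds u)) (proj₂ (bounds u)) u
      slotOf∘from-injective : Injective _≡_ _≡_ (slotOf ∘ from)
      slotOf∘from-injective {i} {i′} eq =
        let same , close = slot-≡⇒DistLe (c (from i)) (c (from i′)) eq
        in Injection.injective (↔⇒↣ (↔-sym enumeration))
             (decidable-stable (from i ≟ᵥ from i′) λ ne → packing _ _ ne same close)

-- The Sierpiński product of two complete graphs

module SierpinskiComplete {m n : ℕ} (f : Fin m → Fin n) where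
  X : Graph
  X = Sierpinski (K m) (K n) f

  private variable
    g g′ : Fin m
    x y h : Fin n
    u v : V X
    s : Fin n → Fin m

  SEdge-⇔ : ((g ≡ g′ × x ≢ y) ⊎ (g ≢ g′ × x ≡ f g′ × y ≡ f g)) ⇔ E X (g , x) (g′ , y)
  SEdge-⇔ = mk⇔ (λ { (inj₁ (refl , x≢y)) → inner _ x≢y ; (inj₂ (g≢g′ , refl , refl)) → outer g≢g′ })
                (λ { (inner _ x≢y) → inj₁ (refl , x≢y) ; (outer g≢g′) → inj₂ (g≢g′ , refl , refl) })

  SEdge? : ∀ u v → Dec (E X u v)
  SEdge? (g , x) (g′ , y) = Dec.map SEdge-⇔
    ((g Fin.≟ g′ ×-dec ¬? (x Fin.≟ y)) ⊎-dec (¬? (g Fin.≟ g′) ×-dec x Fin.≟ f g′ ×-dec y Fin.≟ f g))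

  open FiniteGraph X (↔-sym Fin.*↔×) SEdge? public

  SEdge-sym : E X u v → E X v u
  SEdge-sym (inner g x≢y)  = inner g (x≢y ∘ sym)
  SEdge-sym (outer g≢g′) = outer (g≢g′ ∘ sym)

  DistLe-inner : DistLe X (g , x) (g , y) 1
  DistLe-inner {g} {x} {y} with x Fin.≟ y
  ... | yes refl = DistLe-mono z≤n DistLe-refl
  ... | no x≢y   = DistLe-step (inj₁ (inner g x≢y))

  DistLe-outer : g ≢ g′ → DistLe X (g , f g′) (g′ , f g) 1
  DistLe-outer g≢g′ = DistLe-step (inj₁ (outer g≢g′))

  diameter≤3 : ∀ u v → DistLe X u v 3
  diameter≤3 (g , x) (g′ , y) with g Fin.≟ g′
  ... | yes refl = DistLe-mono (s≤s z≤n) DistLe-inner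
  ... | no g≢g′  = DistLe-trans DistLe-inner (DistLe-trans (DistLe-outer g≢g′) DistLe-inner)

  DistLe-copy : proj₁ u ≡ proj₁ v → DistLe X u v 1
  DistLe-copy {_ , _} {_ , _} refl = DistLe-inner

  DistLe-outer² : ∀ {g₂} → g ≢ g₂ → g₂ ≢ g′ → f g ≡ f g′ → DistLe X (g , f g₂) (g′ , f g₂) 2
  DistLe-outer² {g′ = g′} {g₂ = g₂} g≢g₂ g₂≢g′ fg≡fg′ =
    DistLe-trans (DistLe-outer g≢g₂)
                 (subst (λ z → DistLe X (g₂ , z) (g′ , f g₂) 1) (sym fg≡fg′) (DistLe-outer g₂≢g′))

  SEdge-between-copies : g ≢ g′ → E X (g , x) (g′ , y) → x ≡ f g′ × y ≡ f g
  SEdge-between-copies g≢g′ (inner _ _) = ⊥-elim (g≢g′ refl)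
  SEdge-between-copies _    (outer _)   = refl , refl

  DistLe₁-between-copies : g ≢ g′ → DistLe X (g , x) (g′ , y) 1 → x ≡ f g′ × y ≡ f g
  DistLe₁-between-copies g≢g′ (zero , _ , nil _) = ⊥-elim (g≢g′ refl)
  DistLe₁-between-copies g≢g′ (1 , _ , step e (nil _)) = SEdge-between-copies g≢g′ ([ id , SEdge-sym ]′ e)
  DistLe₁-between-copies _    (suc (suc _) , s≤s () , _)

  DistLe₂-between-copies : g ≢ g′ → DistLe X (g , x) (g′ , y) 2 →
                           x ≡ f g′ ⊎ y ≡ f g ⊎ ∃ λ g₂ → x ≡ f g₂ × y ≡ f g₂
  DistLe₂-between-copies g≢g′ (2 , _ , step e (step e′ (nil _))) =
    twoEdges g≢g′ ([ id , SEdge-sym ]′ e) ([ id , SEdge-sym ]′ e′)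
    where
    twoEdges : ∀ {w} → g ≢ g′ → E X (g , x) w → E X w (g′ , y) →
               x ≡ f g′ ⊎ y ≡ f g ⊎ ∃ λ g₂ → x ≡ f g₂ × y ≡ f g₂
    twoEdges g≢g′ (inner _ _) e′          = inj₂ (inj₁ (proj₂ (SEdge-between-copies g≢g′ e′)))
    twoEdges _    (outer _)   e′ with Equivalence.from SEdge-⇔ e′
    ... | inj₁ (refl , _)       = inj₁ refl
    ... | inj₂ (_ , _ , y≡fg₂) = inj₂ (inj₂ (_ , refl , y≡fg₂))
  DistLe₂-between-copies g≢g′ (0 , _ , p) = inj₁ (proj₁ (DistLe₁-between-copies g≢g′ (0 , z≤n , p)))
  DistLe₂-between-copies g≢g′ (1 , _ , p) = inj₁ (proj₁ (DistLe₁-between-copies g≢g′ (1 , ≤-refl , p)))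
  DistLe₂-between-copies _    (suc (suc (suc _)) , s≤s (s≤s ()) , _)

  Row : Fin n → Pred (V X) 0ℓ
  Row h (_ , x) = x ≡ h

  Shifted : (Fin n → Fin n) → Pred (V X) 0ℓ
  Shifted σ (g , x) = x ≡ σ (f g)

  Canonical : (Fin n → Fin m) → Pred (V X) 0ℓ
  Canonical s (g , x) = f g ≡ x × s x ≡ g

  Row-packing : (∀ g → f g ≢ h) → IsPacking X 2 (Row h)
  Row-packing h∉f {g , _} {g′ , _} refl refl u≢v d with g Fin.≟ g′
  ... | yes refl = u≢v refl
  ... | no g≢g′  = [ h∉f g′ ∘ sym , [ h∉f g ∘ sym , (λ (g₂ , h≡fg₂ , _) → h∉f g₂ (sym h≡fg₂)) ]′ ]′
                     (DistLe₂-between-copies g≢g′ d)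

  Shifted-packing : ∀ σ → (∀ h → σ (σ h) ≢ h) → IsPacking X 1 (Shifted σ)
  Shifted-packing σ σ²≢id {g , _} {g′ , _} refl refl u≢v d with g Fin.≟ g′
  ... | yes refl = u≢v refl
  ... | no g≢g′  = let σfg≡fg′ , σfg′≡fg = DistLe₁-between-copies g≢g′ d
                   in σ²≢id (f g) (trans (cong σ σfg≡fg′) σfg′≡fg)

  Canonical-packing : ∀ s → IsPacking X 2 (Canonical s)
  Canonical-packing s {g , x} {g′ , y} (fg≡x , sx≡g) (fg′≡y , sy≡g′) u≢v d with g Fin.≟ g′
  ... | yes refl = u≢v (cong (g ,_) (trans (sym fg≡x) fg′≡y))
  ... | no g≢g′  = g≢g′ (trans (sym sx≡g) (trans (cong s x≡y) sy≡g′))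
    where
    x≡y : x ≡ y
    x≡y = [ (λ x≡fg′ → trans x≡fg′ fg′≡y) ,
          [ (λ y≡fg → trans (sym fg≡x) (sym y≡fg)) ,
            (λ (_ , x≡fg₂ , y≡fg₂) → trans x≡fg₂ (sym y≡fg₂)) ]′ ]′ (DistLe₂-between-copies g≢g′ d)

  Row-AtLeast : AtLeast m (Row h)
  Row-AtLeast {h} = mkAtLeast (λ g → g , h) (cong proj₁) λ _ → refl

  Shifted-AtLeast : ∀ σ → AtLeast m (Shifted σ)
  Shifted-AtLeast σ = mkAtLeast (λ g → g , σ (f g)) (cong proj₁) λ _ → refl

  Canonical-AtLeast : ∀ s → AtLeast a (λ h → f (s h) ≡ h) → AtLeast a (Canonical s)
  Canonical-AtLeast s (mkAtLeast e e-injective fse≡e) =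
    mkAtLeast (λ i → s (e i) , e i) (e-injective ∘ cong proj₂) λ i → fse≡e i , refl

  Row? : ∀ h → Decidable (Row h)
  Row? h (_ , x) = x Fin.≟ h

  Shifted? : ∀ σ → Decidable (Shifted σ)
  Shifted? σ (g , x) = x Fin.≟ σ (f g)

  Canonical? : ∀ s → Decidable (Canonical s)
  Canonical? s (g , x) = f g Fin.≟ x ×-dec s x Fin.≟ g

  surjective-PackingPair : (surj : ∀ h → ∃ λ g → f g ≡ h) → ∀ σ → (∀ h → σ h ≢ h) → (∀ h → σ (σ h) ≢ h) →
                           PackingPair X (m + n)
  surjective-PackingPair surj σ σ≢id σ²≢id = record
    { I₁         = Shifted σ
    ; I₂         = Canonical (proj₁ ∘ surj)
    ; I₁?        = Shifted? σ
    ; I₂?        = Canonical? (proj₁ ∘ surj)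
    ; I₁-packing = Shifted-packing σ σ²≢id
    ; I₂-packing = Canonical-packing (proj₁ ∘ surj)
    ; size       = AtLeast-∪ disjoint (Shifted-AtLeast σ)
                             (Canonical-AtLeast (proj₁ ∘ surj) (mkAtLeast id id (proj₂ ∘ surj)))
    }
    where
    disjoint : Shifted σ ⊥ Canonical (proj₁ ∘ surj)
    disjoint {g , _} (x≡σfg , fg≡x , _) = σ≢id (f g) (sym (trans fg≡x x≡σfg))

  missedTwice-PackingPair : ∀ {h₀ h₁} → h₁ ≢ h₀ → (∀ g → f g ≢ h₀) → (∀ g → f g ≢ h₁) → PackingPair X (m + m)
  missedTwice-PackingPair {h₀} {h₁} h₁≢h₀ h₀∉f h₁∉f = record
    { I₁         = Row h₁
    ; I₂         = Row h₀
    ; I₁?        = Row? h₁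
    ; I₂?        = Row? h₀
    ; I₁-packing = IsPacking-mono (s≤s z≤n) (Row-packing h₁∉f)
    ; I₂-packing = Row-packing h₀∉f
    ; size       = AtLeast-∪ (λ (x≡h₁ , x≡h₀) → h₁≢h₀ (trans (sym x≡h₁) x≡h₀)) Row-AtLeast Row-AtLeast
    }

  missed-leftInverse-PackingPair : ∀ {h₀} s → (∀ g → f g ≢ h₀) → (∀ g → s (f g) ≡ g) → PackingPair X (m + m)
  missed-leftInverse-PackingPair {h₀} s h₀∉f sf≡id = record
    { I₁         = Canonical s
    ; I₂         = Row h₀
    ; I₁?        = Canonical? s
    ; I₂?        = Row? h₀
    ; I₁-packing = IsPacking-mono (s≤s z≤n) (Canonical-packing s)
    ; I₂-packing = Row-packing h₀∉f
    ; size       = AtLeast-∪ disjoint (Canonical-AtLeast s (mkAtLeast f f-injective (cong f ∘ sf≡id)))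
                             Row-AtLeast
    }
    where
    f-injective : Injective _≡_ _≡_ f
    f-injective {g} {g′} eq = trans (sym (sf≡id g)) (trans (cong s eq) (sf≡id g′))
    disjoint : Canonical s ⊥ Row h₀
    disjoint {g , _} ((fg≡x , _) , x≡h₀) = h₀∉f g (trans fg≡x x≡h₀)

  HasPackingColoring⇒m*n≤m+m+[j∸2] : ∀ {j} → HasPackingColoring X j → m * n ≤ m + m + (j ∸ 2)
  HasPackingColoring⇒m*n≤m+m+[j∸2] =
    HasPackingColoring⇒≤ diameter≤3 proj₁ DistLe-copy proj₁ (DistLe-mono (s≤s z≤n) ∘ DistLe-copy)

  module _ {h₀ : Fin n} (surj : ∀ h → ∃ λ g → f g ≡ h) 
           (injective-off-h₀ : ∀ {g g′} → f g ≢ h₀ → f g ≡ f g′ → g ≡ g′) where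

    label : V X → Fin n
    label (g , x) with f g Fin.≟ h₀
    ... | yes _ = x
    ... | no  _ = f g

    DistLe₂-over-h₀ : f g ≡ h₀ → f g′ ≡ h₀ → DistLe X (g , x) (g′ , x) 2
    DistLe₂-over-h₀ {g} {g′} {x} fg≡h₀ fg′≡h₀ with g Fin.≟ g′ | x Fin.≟ h₀ | surj x
    ... | yes refl | _        | _            = DistLe-mono z≤n DistLe-refl
    ... | no g≢g′  | yes x≡h₀ | _            =
      DistLe-mono (s≤s z≤n) (subst₂ (λ y z → DistLe X (g , y) (g′ , z) 1)
                                    (trans fg′≡h₀ (sym x≡h₀)) (trans fg≡h₀ (sym x≡h₀)) (DistLe-outer g≢g′))
    ... | no g≢g′  | no x≢h₀  | g₂ , fg₂≡x =
      subst (λ z → DistLe X (g , z) (g′ , z) 2) fg₂≡x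
            (DistLe-outer² (λ { refl → x≢h₀ (trans (sym fg₂≡x) fg≡h₀) })
                           (λ { refl → x≢h₀ (trans (sym fg₂≡x) fg′≡h₀) })
                           (trans fg≡h₀ (sym fg′≡h₀)))

    label-≡⇒DistLe₂ : label u ≡ label v → DistLe X u v 2
    label-≡⇒DistLe₂ {g , x} {g′ , y} eq with f g Fin.≟ h₀ | f g′ Fin.≟ h₀ | eq
    ... | no fg≢h₀ | no _      | fg≡fg′ with refl ← injective-off-h₀ fg≢h₀ fg≡fg′ = DistLe-mono (s≤s z≤n) DistLe-inner
    ... | no fg≢h₀ | yes fg′≡h₀ | refl = DistLe-trans DistLe-inner (DistLe-outer λ { refl → fg≢h₀ fg′≡h₀ })
    ... | yes fg≡h₀ | no fg′≢h₀ | refl = DistLe-trans (DistLe-outer λ { refl → fg′≢h₀ fg≡h₀ }) DistLe-inner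
    ... | yes fg≡h₀ | yes fg′≡h₀ | refl = DistLe₂-over-h₀ fg≡h₀ fg′≡h₀

    HasPackingColoring⇒m*n≤m+n+[j∸2] : ∀ {j} → HasPackingColoring X j → m * n ≤ m + n + (j ∸ 2)
    HasPackingColoring⇒m*n≤m+n+[j∸2] = HasPackingColoring⇒≤ diameter≤3 proj₁ DistLe-copy label label-≡⇒DistLe₂

-- An independent set and a 2-packing for every f

module _ {m n : ℕ} (f : Fin m → Fin (suc n)) where
  open SierpinskiComplete f

  missedOnce-PackingPair : ∀ {h₀ g* y} (s : Fin (suc n) → Fin m) → (∀ g → f g ≢ h₀) →
                           (∀ h → h ≢ h₀ → f (s h) ≡ h) → s (f g*) ≢ g* → y ≢ f g* → y ≢ h₀ →
                           PackingPair X (suc n + m)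
  missedOnce-PackingPair {h₀} {g*} {y} s h₀∉f s-section g*-not-canonical y≢fg* y≢h₀ = record
    { I₁         = ｛ g* , y ｝ ∪ Canonical s
    ; I₂         = Row h₀
    ; I₁?        = λ u → (g* , y) ≟ᵥ u ⊎-dec Canonical? s u
    ; I₂?        = Row? h₀
    ; I₁-packing = IsPacking-∪ IsPacking-｛｝ (IsPacking-mono (s≤s z≤n) (Canonical-packing s)) extra-far
    ; I₂-packing = Row-packing h₀∉f
    ; size       = AtLeast-∪ I₁⊥Row (AtLeast-∪ extra∉Canonical AtLeast-｛｝ (Canonical-AtLeast s hits))
                             Row-AtLeast
    }
    where
    extra-far : ∀ {u v} → ｛ g* , y ｝ u → Canonical s v → DistGt X u v 1
    extra-far {v = g , x} refl (fg≡x , sx≡g) d with g* Fin.≟ g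
    ... | yes refl = g*-not-canonical (trans (cong s fg≡x) sx≡g)
    ... | no g*≢g  = let y≡fg , x≡fg* = DistLe₁-between-copies g*≢g d
                     in y≢fg* (trans y≡fg (trans fg≡x x≡fg*))
    extra∉Canonical : ｛ g* , y ｝ ⊥ Canonical s
    extra∉Canonical (refl , fg*≡y , _) = y≢fg* (sym fg*≡y)
    I₁⊥Row : (｛ g* , y ｝ ∪ Canonical s) ⊥ Row h₀
    I₁⊥Row (inj₁ refl , y≡h₀)               = y≢h₀ y≡h₀
    I₁⊥Row {g , _} (inj₂ (fg≡x , _) , x≡h₀) = h₀∉f g (trans fg≡x x≡h₀)
    hits : AtLeast n (λ h → f (s h) ≡ h)
    hits = mkAtLeast (Fin.punchIn h₀) (Fin.punchIn-injective h₀ _ _)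
                     (λ i → s-section _ (Fin.punchInᵢ≢i h₀ i))

shift : ∀ {n} → Fin (3 + n) → Fin (3 + n)
shift 0F = 1F
shift 1F = 2F
shift _  = 0F

shift-≢ : ∀ {n} (h : Fin (3 + n)) → shift h ≢ h
shift-≢ 0F ()
shift-≢ 1F ()
shift-≢ 2F ()
shift-≢ (Fin.suc (Fin.suc (Fin.suc _))) ()

shift²-≢ : ∀ {n} (h : Fin (3 + n)) → shift (shift h) ≢ h
shift²-≢ 0F ()
shift²-≢ 1F ()
shift²-≢ 2F ()
shift²-≢ (Fin.suc (Fin.suc (Fin.suc _))) ()

avoid : ∀ {n} → Fin (3 + n) → Fin (3 + n) → Fin (3 + n)
avoid a b with shift a Fin.≟ b
... | yes _ = shift b
... | no  _ = shift a

avoid-≢ˡ : ∀ {n} (a b : Fin (3 + n)) → avoid a b ≢ a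
avoid-≢ˡ a b with shift a Fin.≟ b
... | yes refl = shift²-≢ a
... | no  _    = shift-≢ a

avoid-≢ʳ : ∀ {n} (a b : Fin (3 + n)) → avoid a b ≢ b
avoid-≢ʳ a b with shift a Fin.≟ b
... | yes _    = shift-≢ b
... | no sa≢b = sa≢b

module _ {m n : ℕ} (f : Fin m → Fin (3 + n)) where
  open SierpinskiComplete f

  module _ {h₀} (h₀∉f : ∀ g → f g ≢ h₀) (hit : ∀ h → h ≢ h₀ → ∃ λ g → f g ≡ h) where

    -- h₀ has no preimage; its image under section is an arbitrary copy.
    section : Fin (3 + n) → Fin m
    section h with h Fin.≟ h₀
    ... | yes _    = proj₁ (hit (shift h₀) (shift-≢ h₀))
    ... | no h≢h₀ = proj₁ (hit h h≢h₀)

    section-correct : ∀ h → h ≢ h₀ → f (section h) ≡ h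
    section-correct h h≢h₀ with h Fin.≟ h₀
    ... | yes h≡h₀  = ⊥-elim (h≢h₀ h≡h₀)
    ... | no h≢h₀′ = proj₂ (hit h h≢h₀′)

    missedOnce-PackingPair-≥ : ∃ λ a → PackingPair X a × m + m ⊓ (3 + n) ≤ a
    missedOnce-PackingPair-≥ with Fin.any? (λ g → ¬? (section (f g) Fin.≟ g))
    ... | yes (g* , g*-not-canonical) =
      _ , missedOnce-PackingPair f section h₀∉f section-correct g*-not-canonical
                                 (avoid-≢ˡ (f g*) h₀) (avoid-≢ʳ (f g*) h₀) ,
      ≤-trans (+-monoʳ-≤ m (m⊓n≤n m _)) (≤-reflexive (+-comm m _))
    ... | no ¬non-canonical =
      _ , missed-leftInverse-PackingPair section h₀∉f
            (λ g → decidable-stable (section (f g) Fin.≟ g) (¬non-canonical ∘ (g ,_))) ,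
      +-monoʳ-≤ m (m⊓n≤m m _)

  PackingPair-≥ : ∃ λ a → PackingPair X a × m + m ⊓ (3 + n) ≤ a
  PackingPair-≥ with Fin.all? (λ h → Fin.any? (λ g → f g Fin.≟ h))
  ... | yes surj = _ , surjective-PackingPair surj shift shift-≢ shift²-≢ , +-monoʳ-≤ m (m⊓n≤n m _)
  ... | no ¬surj with Fin.¬∀⟶∃¬ _ _ (λ h → Fin.any? (λ g → f g Fin.≟ h)) ¬surj
  ... | h₀ , h₀∉f with Fin.any? (λ h → ¬? (h Fin.≟ h₀) ×-dec ¬? (Fin.any? (λ g → f g Fin.≟ h)))
  ...   | yes (h₁ , h₁≢h₀ , h₁∉f) =
    _ , missedTwice-PackingPair h₁≢h₀ (λ g → h₀∉f ∘ (g ,_)) (λ g → h₁∉f ∘ (g ,_)) , +-monoʳ-≤ m (m⊓n≤m m _)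
  ...   | no ¬h₁ = missedOnce-PackingPair-≥ (λ g → h₀∉f ∘ (g ,_))
                     (λ h h≢h₀ → decidable-stable (Fin.any? (λ g → f g Fin.≟ h)) (λ h∉f → ¬h₁ (h , h≢h₀ , h∉f)))

-- The extremal values

clamp : ∀ {m n} → Fin n → Fin m → Fin n
clamp {n = n} a g with toℕ g <? n
... | yes g<n = Fin.fromℕ< g<n
... | no  _   = a

module _ {m n : ℕ} {a : Fin n} where

  toℕ-clamp : ∀ (g : Fin m) → clamp a g ≢ a → toℕ (clamp a g) ≡ toℕ g
  toℕ-clamp g clamp≢a with toℕ g <? n
  ... | yes g<n = Fin.toℕ-fromℕ< g<n
  ... | no  _   = ⊥-elim (clamp≢a refl)

  clamp-injective : ∀ {g g′ : Fin m} → clamp a g ≢ a → clamp a g ≡ clamp a g′ → g ≡ g′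
  clamp-injective {g} {g′} clamp≢a eq = Fin.toℕ-injective (begin
    toℕ g            ≡⟨ toℕ-clamp g clamp≢a ⟨
    toℕ (clamp a g)  ≡⟨ cong toℕ eq ⟩
    toℕ (clamp a g′) ≡⟨ toℕ-clamp g′ (clamp≢a ∘ trans eq) ⟩
    toℕ g′           ∎)
    where open ≡-Reasoning

  clamp-inject≤ : ∀ (n≤m : n ≤ m) h → clamp a (Fin.inject≤ h n≤m) ≡ h
  clamp-inject≤ n≤m h with toℕ (Fin.inject≤ h n≤m) <? n
  ... | yes lt = Fin.toℕ-injective (trans (Fin.toℕ-fromℕ< lt) (Fin.toℕ-inject≤ h n≤m))
  ... | no ¬lt = ⊥-elim (¬lt (subst (_< n) (sym (Fin.toℕ-inject≤ h n≤m)) (Fin.toℕ<n h)))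

N∸c+2≤j : ∀ {c N} j → c < N → N ≤ c + (j ∸ 2) → N ∸ c + 2 ≤ j
N∸c+2≤j {c} {N} 0 c<N N≤c+0 = ⊥-elim (<⇒≱ c<N (subst (N ≤_) (+-identityʳ c) N≤c+0))
N∸c+2≤j {c} {N} 1 c<N N≤c+0 = ⊥-elim (<⇒≱ c<N (subst (N ≤_) (+-identityʳ c) N≤c+0))
N∸c+2≤j {c} {N} (suc (suc j)) _ N≤c+j =
  subst (N ∸ c + 2 ≤_) (+-comm j 2) (+-monoˡ-≤ 2 (subst (N ∸ c ≤_) (m+n∸m≡n c j) (∸-monoˡ-≤ c N≤c+j)))

m+m<m*n : ∀ {m n} → 0 < m → 3 ≤ n → m + m < m * n
m+m<m*n {m} {n} 0<m 3≤n = begin-strict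
  m + m       <⟨ m<n+m (m + m) 0<m ⟩
  m + (m + m) ≡⟨ cong (λ t → m + (m + t)) (+-identityʳ m) ⟨
  3 * m       ≤⟨ *-monoˡ-≤ m 3≤n ⟩
  n * m       ≡⟨ *-comm n m ⟩
  m * n       ∎
  where open ≤-Reasoning

IsUpperSierpinskiPCN-K : ∀ {m n} c → 3 ≤ n → c ≤ m + m ⊓ n → c < m * n →
  (∃ λ (f : Fin m → Fin n) → ∀ {j} → HasPackingColoring (Sierpinski (K m) (K n) f) j → m * n ≤ c + (j ∸ 2)) →
  IsUpperSierpinskiPCN (K m) (K n) (m * n ∸ c + 2)
IsUpperSierpinskiPCN-K {m} {n} c (s≤s (s≤s (s≤s _))) c≤m+m⊓n c<m*n (f₀ , lower) =
  (λ f → packingChromaticNumber-≤ f (colouring f)) ,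
  f₀ , colouring f₀ , λ j j<k has → <⇒≱ j<k (N∸c+2≤j j c<m*n (lower has))
  where
  open SierpinskiComplete using (packingChromaticNumber-≤; PackingPair⇒HasPackingColoring)
  colouring : ∀ f → HasPackingColoring (Sierpinski (K m) (K n) f) (m * n ∸ c + 2)
  colouring f = let a , pair , m+m⊓n≤a = PackingPair-≥ f in
    PackingPair⇒HasPackingColoring f pair (begin
      m * n           ≡⟨ m+[n∸m]≡n (<⇒≤ c<m*n) ⟨
      c + (m * n ∸ c) ≤⟨ +-monoˡ-≤ (m * n ∸ c) (≤-trans c≤m+m⊓n m+m⊓n≤a) ⟩
      a + (m * n ∸ c) ∎)
    where open ≤-Reasoning

theorem3p5 : (∀ m n → 3 ≤ m → m ≤ n → IsUpperSierpinskiPCN (K m) (K n) (m * n ∸ 2 * m + 2))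
           × (∀ m n → 3 ≤ n → n ≤ m → IsUpperSierpinskiPCN (K m) (K n) (m * n ∸ m ∸ n + 2))
theorem3p5 = m≤n-case , n≤m-case
  where
  m≤n-case : ∀ m n → 3 ≤ m → m ≤ n → IsUpperSierpinskiPCN (K m) (K n) (m * n ∸ 2 * m + 2)
  m≤n-case m n 3≤m m≤n rewrite +-identityʳ m = IsUpperSierpinskiPCN-K (m + m) 3≤n
    (+-monoʳ-≤ m (≤-reflexive (sym (m≤n⇒m⊓n≡m m≤n))))
    (m+m<m*n (≤-trans (s≤s z≤n) 3≤m) 3≤n)
    (f₀ , SierpinskiComplete.HasPackingColoring⇒m*n≤m+m+[j∸2] f₀)
    where
    3≤n : 3 ≤ n
    3≤n = ≤-trans 3≤m m≤n
    f₀ : Fin m → Fin n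
    f₀ _ = Fin.fromℕ< (≤-trans (s≤s z≤n) 3≤n)

  n≤m-case : ∀ m n → 3 ≤ n → n ≤ m → IsUpperSierpinskiPCN (K m) (K n) (m * n ∸ m ∸ n + 2)
  n≤m-case m n 3≤n n≤m rewrite ∸-+-assoc (m * n) m n = IsUpperSierpinskiPCN-K (m + n) 3≤n
    (+-monoʳ-≤ m (≤-reflexive (sym (m≥n⇒m⊓n≡n n≤m))))
    (≤-<-trans (+-monoʳ-≤ m n≤m) (m+m<m*n (≤-trans (s≤s z≤n) (≤-trans 3≤n n≤m)) 3≤n))
    (f₀ , SierpinskiComplete.HasPackingColoring⇒m*n≤m+n+[j∸2] f₀
            (λ h → Fin.inject≤ h n≤m , clamp-inject≤ n≤m h) clamp-injective)
    where
    f₀ : Fin m → Fin n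
    f₀ = clamp (Fin.fromℕ< (≤-trans (s≤s z≤n) 3≤n))
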